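{- Let $G$ be a matching covered graph, $X\subseteq V(G)$ and $M$ a perfect matching of $G$. Then there is an $M$-conformal set $X'\subseteq V(G)$ such that (1) $X\subseteq X'$, (2) $|X'|\le |X|+\mathrm{mp}(\partial(X))$, and (3) $\mathrm{mp}(\partial(X'))\le 2\,\mathrm{mp}(\partial(X))$.
   Context: A graph is matching covered if it is connected and every edge lies in a perfect matching. For $X\subseteq V(G)$, $\partial(X)$ is the set of edges with exactly one endpoint in $X$, and the matching porosity is $\mathrm{mp}(\partial(X))=\max_{N}|N\cap\partial(X)|$ over all perfect matchings $N$ of $G$. For a perfect matching $M$, a set $S\subseteq V(G)$ is $M$-conformal if the edges of $M$ with both ends in $V(G)\setminus S$ form a perfect matching of $G-S$ and the edges of $M$ with both ends in $S$ form a perfect matching of $G[S]$. -}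

module Defs where

open import Data.Nat using (ℕ; _≤_; _+_; _*_)
open import Data.Fin using (Fin)
open import Data.Fin.Subset using (Subset; _∈_; _∉_; _∩_; ∣_∣)
open import Data.Bool using (Bool; _xor_)
open import Data.Vec using (lookup; tabulate)
open import Data.Product using (Σ; _×_; ∃)
open import Data.Sum using (_⊎_)
open import Relation.Binary.PropositionalEquality using (_≡_; _≢_)

record Graph : Set where
  field
    n     : ℕ
    m     : ℕ
    end₁  : Fin m → Fin n
    end₂  : Fin m → Fin n
    loopless : ∀ e → end₁ e ≢ end₂ e

open Graph public

module _ (G : Graph) where

  Vertex : Set
  Vertex = Fin (n G)

  Edge : Set
  Edge = Fin (m G)

  Incident : Edge → Vertex → Set
  Incident e v = end₁ G e ≡ v ⊎ end₂ G e ≡ v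

  data Walk : Vertex → Vertex → Set where
    here : ∀ {v} → Walk v v
    step₁ : ∀ {v} e → Walk (end₂ G e) v → Walk (end₁ G e) v
    step₂ : ∀ {v} e → Walk (end₁ G e) v → Walk (end₂ G e) v

  Connected : Set
  Connected = ∀ u v → Walk u v

  PerfectMatchingOf : (Vertex → Set) → Subset (m G) → Set
  PerfectMatchingOf P F =
    ∀ v → P v →
      Σ Edge λ e →
        (e ∈ F × P (end₁ G e) × P (end₂ G e) × Incident e v)
        × (∀ e′ → e′ ∈ F → P (end₁ G e′) → P (end₂ G e′) → Incident e′ v → e′ ≡ e)

  PerfectMatching : Subset (m G) → Set
  PerfectMatching F = PerfectMatchingOf (λ _ → ⊤′) F
    where
      open import Data.Unit using () renaming (⊤ to ⊤′)

  MatchingCovered : Set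
  MatchingCovered = Connected × (∀ e → Σ (Subset (m G)) λ N → PerfectMatching N × e ∈ N)

  cut : Subset (n G) → Subset (m G)
  cut X = tabulate (λ e → lookup X (end₁ G e) xor lookup X (end₂ G e))

  -- IsMP X k  :  mp(∂(X)) = k, i.e. k is the maximum of |N ∩ ∂(X)|
  -- over all perfect matchings N of G (attained and an upper bound).
  IsMP : Subset (n G) → ℕ → Set
  IsMP X k =
    (Σ (Subset (m G)) λ N → PerfectMatching N × ∣ N ∩ cut X ∣ ≡ k)
    × (∀ N → PerfectMatching N → ∣ N ∩ cut X ∣ ≤ k)

  Conformal : Subset (m G) → Subset (n G) → Set
  Conformal M S = PerfectMatchingOf (λ v → v ∉ S) M × PerfectMatchingOf (λ v → v ∈ S) M

-- The M-closure X′ of X adds to X the M-partner of every vertex of X.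
-- No edge of M crosses X′, so X′ is M-conformal, and v ↦ (its M-edge)
-- maps X′ ∖ X injectively into M ∩ ∂(X), whence |X′ ∖ X| ≤ mp(∂(X)).
-- For a perfect matching N, an edge of N in ∂(X′) but not in ∂(X) has
-- its end inside X′ in X′ ∖ X, and distinct such edges have distinct
-- ends; hence |N ∩ ∂(X′)| ≤ |N ∩ ∂(X)| + |X′ ∖ X| ≤ 2 mp(∂(X)).
module Submission where

open import Defs
open import Data.Nat using (ℕ; _≤_; _+_; _*_)
open import Data.Fin.Subset using (Subset; _⊆_; ∣_∣)
open import Data.Product using (Σ; _×_)

open import Data.Bool using (Bool; true; false; _∨_; _xor_)
open import Data.Bool.Properties using (∨-zeroʳ)
open import Data.Empty using (⊥-elim)
open import Data.Fin as Fin using (Fin)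
open import Data.Fin.Properties using (suc-injective; any?; all?) renaming (_≟_ to _≟ᶠ_)
open import Data.Fin.Subset using (_∈_; _∉_; _∩_; _─_; _-_; inside; outside)
open import Data.Fin.Subset.Properties
  using (p⊆q⇒∣p∣≤∣q∣; ∣p∩q∣≤∣q∣; p∩q⊆p; p∩q⊆q; x∈p⇒∣p-x∣<∣p∣; x∈p∧x≢y⇒x∈p-y; x∈p∩q⁺; x∈p∧x∉q⇒x∈p─q; p─q⊆p; anySubset?; _∈?_)
open import Data.Nat using (zero; suc; z≤n; s≤s) renaming (_≟_ to _≟ⁿ_)
open import Data.Nat.Properties using (module ≤-Reasoning; ≤-trans; ≤-pred; ≤∧≢⇒<; +-suc; +-mono-≤; +-monoʳ-≤; m≤m+n)
open import Data.Product using (_,_; proj₁; proj₂)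
open import Data.Sum using (_⊎_; inj₁; inj₂)
open import Data.Unit using (tt)
open import Data.Vec using (_∷_; []; lookup; tabulate; here; there)
open import Data.Vec.Properties using ([]=⇒lookup; lookup⇒[]=; lookup∘tabulate)
open import Relation.Nullary using (Dec; yes; no)
open import Relation.Nullary.Decidable using (_×-dec_; _⊎-dec_; _→-dec_)
open import Relation.Unary using (Pred; Decidable)
open import Relation.Binary.PropositionalEquality using (_≡_; _≢_; refl; sym; trans; cong; cong₂; subst)

∣p∣≡∣p∩q∣+∣p─q∣ : ∀ {a} (p q : Subset a) → ∣ p ∣ ≡ ∣ p ∩ q ∣ + ∣ p ─ q ∣
∣p∣≡∣p∩q∣+∣p─q∣ []            []            = refl
∣p∣≡∣p∩q∣+∣p─q∣ (inside ∷ p)  (inside ∷ q)  = cong suc (∣p∣≡∣p∩q∣+∣p─q∣ p q)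
∣p∣≡∣p∩q∣+∣p─q∣ (inside ∷ p)  (outside ∷ q) = trans (cong suc (∣p∣≡∣p∩q∣+∣p─q∣ p q)) (sym (+-suc _ _))
∣p∣≡∣p∩q∣+∣p─q∣ (outside ∷ p) (inside ∷ q)  = ∣p∣≡∣p∩q∣+∣p─q∣ p q
∣p∣≡∣p∩q∣+∣p─q∣ (outside ∷ p) (outside ∷ q) = ∣p∣≡∣p∩q∣+∣p─q∣ p q

x∈p─q⇒x∉q : ∀ {a} {x : Fin a} (p q : Subset a) → x ∈ p ─ q → x ∉ q
x∈p─q⇒x∉q (_ ∷ p) (_ ∷ q)      (there x∈p─q) (there x∈q) = x∈p─q⇒x∉q p q x∈p─q x∈q
x∈p─q⇒x∉q (_ ∷ p) (inside ∷ q) ()            here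

injection⇒∣p∣≤∣q∣ : ∀ {a b ℓ} {p : Subset a} {q : Subset b} (R : Fin a → Fin b → Set ℓ) →
                    (∀ {x} → x ∈ p → Σ (Fin b) λ y → y ∈ q × R x y) →
                    (∀ {x x′ y} → x ∈ p → x′ ∈ p → R x y → R x′ y → x ≡ x′) →
                    ∣ p ∣ ≤ ∣ q ∣
injection⇒∣p∣≤∣q∣ {p = []} R image injective = z≤n
injection⇒∣p∣≤∣q∣ {p = outside ∷ p} R image injective =
  injection⇒∣p∣≤∣q∣ (λ x → R (Fin.suc x)) (λ x∈p → image (there x∈p))
    (λ x∈p x′∈p Rxy Rx′y → suc-injective (injective (there x∈p) (there x′∈p) Rxy Rx′y))
injection⇒∣p∣≤∣q∣ {p = inside ∷ p} {q} R image injective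
  with image here
... | y₀ , y₀∈q , R0y₀ =
  ≤-trans (s≤s (injection⇒∣p∣≤∣q∣ (λ x → R (Fin.suc x)) image-avoids-y₀
                  (λ x∈p x′∈p Rxy Rx′y → suc-injective (injective (there x∈p) (there x′∈p) Rxy Rx′y))))
          (x∈p⇒∣p-x∣<∣p∣ y₀∈q)
  where
  image-avoids-y₀ : ∀ {x} → x ∈ p → Σ (Fin _) λ y → y ∈ q - y₀ × R (Fin.suc x) y
  image-avoids-y₀ x∈p with image (there x∈p)
  ... | y , y∈q , Rxy = y , x∈p∧x≢y⇒x∈p-y y∈q (λ { refl → suc≢zero (injective (there x∈p) here Rxy R0y₀) }) , Rxy
    where
    suc≢zero : ∀ {k} {x : Fin k} → Fin.suc x ≢ Fin.zero
    suc≢zero ()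

greatest : ∀ {ℓ} {P : Pred ℕ ℓ} → Decidable P → ∀ b → (∀ {j} → P j → j ≤ b) →
           ∀ {i} → P i → Σ ℕ λ k → P k × (∀ {j} → P j → j ≤ k)
greatest P? b       P≤b Pi with P? b
... | yes Pb = b , Pb , P≤b
greatest P? zero    P≤b {i} Pi | no _ = i , Pi , λ Pj → ≤-trans (P≤b Pj) z≤n
greatest P? (suc b) P≤b Pi     | no ¬Pb =
  greatest P? b (λ Pj → ≤-pred (≤∧≢⇒< (P≤b Pj) (λ { refl → ¬Pb Pj }))) Pi

∉⇒lookup≡false : ∀ {a} {p : Subset a} {x} → x ∉ p → lookup p x ≡ false
∉⇒lookup≡false {p = p} {x} x∉p with lookup p x in eq
... | true  = ⊥-elim (x∉p (lookup⇒[]= x p eq))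
... | false = refl

lookup≡false⇒∉ : ∀ {a} {p : Subset a} {x} → lookup p x ≡ false → x ∉ p
lookup≡false⇒∉ eq x∈p with trans (sym ([]=⇒lookup x∈p)) eq
... | ()

∈-tabulate⁺ : ∀ {a} {f : Fin a → Bool} {x} → f x ≡ true → x ∈ tabulate f
∈-tabulate⁺ {f = f} {x} fx = lookup⇒[]= x (tabulate f) (trans (lookup∘tabulate f x) fx)

∈-tabulate⁻ : ∀ {a} {f : Fin a → Bool} {x} → x ∈ tabulate f → f x ≡ true
∈-tabulate⁻ {f = f} {x} x∈ = trans (sym (lookup∘tabulate f x)) ([]=⇒lookup x∈)

module _ (G : Graph) where

  perfectMatchingOf? : ∀ {P : Vertex G → Set} → Decidable P → Decidable (PerfectMatchingOf G P)
  perfectMatchingOf? P? F = all? λ v → P? v →-dec any? λ e →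
      ((e ∈? F) ×-dec P? (end₁ G e) ×-dec P? (end₂ G e) ×-dec incident? e v) ×-dec
      all? λ e′ → (e′ ∈? F) →-dec P? (end₁ G e′) →-dec P? (end₂ G e′) →-dec
                  incident? e′ v →-dec (e′ ≟ᶠ e)
    where
    incident? : ∀ e v → Dec (Incident G e v)
    incident? e v = (end₁ G e ≟ᶠ v) ⊎-dec (end₂ G e ≟ᶠ v)

  perfectMatching? : Decidable (PerfectMatching G)
  perfectMatching? = perfectMatchingOf? (λ _ → yes tt)

  IsMP-exists : ∀ {M} → PerfectMatching G M → (S : Subset (n G)) (b : ℕ) →
                (∀ N → PerfectMatching G N → ∣ N ∩ cut G S ∣ ≤ b) →
                Σ ℕ λ k → IsMP G S k × k ≤ b
  IsMP-exists {M} M-pm S b ∣N∩∂S∣≤b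
    with greatest attained? b (λ { (N , N-pm , refl) → ∣N∩∂S∣≤b N N-pm }) (M , M-pm , refl)
    where
    attained? : Decidable (λ j → Σ (Subset (m G)) λ N → PerfectMatching G N × ∣ N ∩ cut G S ∣ ≡ j)
    attained? j = anySubset? λ N → perfectMatching? N ×-dec (∣ N ∩ cut G S ∣ ≟ⁿ j)
  ... | k , (N , N-pm , refl) , greatest-k =
    k , ((N , N-pm , refl) , λ N′ N′-pm → greatest-k (N′ , N′-pm , refl)) , ∣N∩∂S∣≤b N N-pm

  module _ (S : Subset (n G)) where

    Touches : Edge G → Set
    Touches e = end₁ G e ∈ S ⊎ end₂ G e ∈ S

    Crosses : Edge G → Set
    Crosses e = end₁ G e ∈ S × end₂ G e ∉ S ⊎ end₁ G e ∉ S × end₂ G e ∈ S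

    touches : Edge G → Bool
    touches e = lookup S (end₁ G e) ∨ lookup S (end₂ G e)

    touches≡true⇒Touches : ∀ {e} → touches e ≡ true → Touches e
    touches≡true⇒Touches {e} t with lookup S (end₁ G e) in eq
    ... | true  = inj₁ (lookup⇒[]= _ S eq)
    ... | false = inj₂ (lookup⇒[]= _ S t)

    Touches⇒touches≡true : ∀ {e} → Touches e → touches e ≡ true
    Touches⇒touches≡true (inj₁ e₁∈S) rewrite []=⇒lookup e₁∈S = refl
    Touches⇒touches≡true {e} (inj₂ e₂∈S) rewrite []=⇒lookup e₂∈S = ∨-zeroʳ (lookup S (end₁ G e))

    Crosses⇒∈cut : ∀ {e} → Crosses e → e ∈ cut G S
    Crosses⇒∈cut (inj₁ (e₁∈S , e₂∉S)) = ∈-tabulate⁺ (cong₂ _xor_ ([]=⇒lookup e₁∈S) (∉⇒lookup≡false e₂∉S))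
    Crosses⇒∈cut (inj₂ (e₁∉S , e₂∈S)) = ∈-tabulate⁺ (cong₂ _xor_ (∉⇒lookup≡false e₁∉S) ([]=⇒lookup e₂∈S))

    ∈cut⇒Crosses : ∀ {e} → e ∈ cut G S → Crosses e
    ∈cut⇒Crosses {e} e∈∂S
      with lookup S (end₁ G e) in eq₁ | lookup S (end₂ G e) in eq₂ | ∈-tabulate⁻ e∈∂S
    ... | true  | false | _ = inj₁ (lookup⇒[]= _ S eq₁ , lookup≡false⇒∉ eq₂)
    ... | false | true  | _ = inj₂ (lookup≡false⇒∉ eq₁ , lookup⇒[]= _ S eq₂)

  module _ {S : Subset (n G)} where

    incident-∈⇒Touches : ∀ {e v} → Incident G e v → v ∈ S → Touches S e
    incident-∈⇒Touches (inj₁ refl) v∈S = inj₁ v∈S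
    incident-∈⇒Touches (inj₂ refl) v∈S = inj₂ v∈S

    incident-∉⇒Touches⇒∈cut : ∀ {e v} → Incident G e v → v ∉ S → Touches S e → e ∈ cut G S
    incident-∉⇒Touches⇒∈cut (inj₁ refl) v∉S (inj₁ v∈S)  = ⊥-elim (v∉S v∈S)
    incident-∉⇒Touches⇒∈cut (inj₁ refl) v∉S (inj₂ e₂∈S) = Crosses⇒∈cut S (inj₂ (v∉S , e₂∈S))
    incident-∉⇒Touches⇒∈cut (inj₂ refl) v∉S (inj₁ e₁∈S) = Crosses⇒∈cut S (inj₁ (e₁∈S , v∉S))
    incident-∉⇒Touches⇒∈cut (inj₂ refl) v∉S (inj₂ v∈S)  = ⊥-elim (v∉S v∈S)

    Touches⇒ends-∉-unique : ∀ {e v w} → Touches S e → Incident G e v → Incident G e w →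
                            v ∉ S → w ∉ S → v ≡ w
    Touches⇒ends-∉-unique _             (inj₁ refl) (inj₁ refl) _   _   = refl
    Touches⇒ends-∉-unique _             (inj₂ refl) (inj₂ refl) _   _   = refl
    Touches⇒ends-∉-unique (inj₁ e₁∈S)  (inj₁ refl) (inj₂ refl) v∉S _   = ⊥-elim (v∉S e₁∈S)
    Touches⇒ends-∉-unique (inj₂ e₂∈S)  (inj₁ refl) (inj₂ refl) _   w∉S = ⊥-elim (w∉S e₂∈S)
    Touches⇒ends-∉-unique (inj₁ e₁∈S)  (inj₂ refl) (inj₁ refl) _   w∉S = ⊥-elim (w∉S e₁∈S)
    Touches⇒ends-∉-unique (inj₂ e₂∈S)  (inj₂ refl) (inj₁ refl) v∉S _   = ⊥-elim (v∉S e₂∈S)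

  ∈cut-∉cut⇒end∈─ : ∀ {X Y : Subset (n G)} {e} → X ⊆ Y →
                    e ∈ cut G Y → e ∉ cut G X → Σ (Vertex G) λ v → v ∈ Y ─ X × Incident G e v
  ∈cut-∉cut⇒end∈─ {X} {Y} {e} X⊆Y e∈∂Y e∉∂X with ∈cut⇒Crosses Y e∈∂Y
  ... | inj₁ (e₁∈Y , e₂∉Y) = end₁ G e , x∈p∧x∉q⇒x∈p─q e₁∈Y e₁∉X , inj₁ refl
    where
    e₁∉X : end₁ G e ∉ X
    e₁∉X e₁∈X = e∉∂X (Crosses⇒∈cut X (inj₁ (e₁∈X , λ e₂∈X → e₂∉Y (X⊆Y e₂∈X))))
  ... | inj₂ (e₁∉Y , e₂∈Y) = end₂ G e , x∈p∧x∉q⇒x∈p─q e₂∈Y e₂∉X , inj₂ refl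
    where
    e₂∉X : end₂ G e ∉ X
    e₂∉X e₂∈X = e∉∂X (Crosses⇒∈cut X (inj₂ ((λ e₁∈X → e₁∉Y (X⊆Y e₁∈X)) , e₂∈X)))

  module _ {N : Subset (m G)} (N-pm : PerfectMatching G N) where

    matchedEdge : Vertex G → Edge G
    matchedEdge v = proj₁ (N-pm v tt)

    matchedEdge-∈ : ∀ v → matchedEdge v ∈ N
    matchedEdge-∈ v = proj₁ (proj₁ (proj₂ (N-pm v tt)))

    matchedEdge-incident : ∀ v → Incident G (matchedEdge v) v
    matchedEdge-incident v = proj₂ (proj₂ (proj₂ (proj₁ (proj₂ (N-pm v tt)))))

    matchedEdge-unique : ∀ {v e} → e ∈ N → Incident G e v → e ≡ matchedEdge v
    matchedEdge-unique {v} e∈N e∼v = proj₂ (proj₂ (N-pm v tt)) _ e∈N tt tt e∼v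

    matchedEdge-of-end : ∀ {v w} → Incident G (matchedEdge v) w → matchedEdge w ≡ matchedEdge v
    matchedEdge-of-end w∼ = sym (matchedEdge-unique (matchedEdge-∈ _) w∼)

    perfectMatchingOf-closed : (P : Vertex G → Set) →
                               (∀ {v w} → Incident G (matchedEdge v) w → P v → P w) →
                               PerfectMatchingOf G P N
    perfectMatchingOf-closed P closed v Pv =
      matchedEdge v , (matchedEdge-∈ v , closed (inj₁ refl) Pv , closed (inj₂ refl) Pv , matchedEdge-incident v)
                    , λ e e∈N _ _ e∼v → matchedEdge-unique e∈N e∼v

    closed⇒conformal : (S : Subset (n G)) →
                       (∀ {v w} → Incident G (matchedEdge v) w → v ∈ S → w ∈ S) →
                       Conformal G N S
    closed⇒conformal S closed =
      perfectMatchingOf-closed (_∉ S) (λ w∼ v∉S w∈S → v∉S (closed (flip w∼) w∈S)) ,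
      perfectMatchingOf-closed (_∈ S) closed
      where
      flip : ∀ {v w} → Incident G (matchedEdge v) w → Incident G (matchedEdge w) v
      flip {v} w∼ = subst (λ e → Incident G e v) (sym (matchedEdge-of-end w∼)) (matchedEdge-incident v)

  module _ (X : Subset (n G)) {M : Subset (m G)} (M-pm : PerfectMatching G M) where

    closure : Subset (n G)
    closure = tabulate λ v → touches X (matchedEdge M-pm v)

    ∈closure⁺ : ∀ {v} → Touches X (matchedEdge M-pm v) → v ∈ closure
    ∈closure⁺ t = ∈-tabulate⁺ (Touches⇒touches≡true X t)

    ∈closure⁻ : ∀ {v} → v ∈ closure → Touches X (matchedEdge M-pm v)
    ∈closure⁻ v∈X′ = touches≡true⇒Touches X (∈-tabulate⁻ v∈X′)

    X⊆closure : X ⊆ closure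
    X⊆closure {v} v∈X = ∈closure⁺ (incident-∈⇒Touches (matchedEdge-incident M-pm v) v∈X)

    closure-conformal : Conformal G M closure
    closure-conformal = closed⇒conformal M-pm closure λ w∼ v∈X′ →
      ∈closure⁺ (subst (Touches X) (sym (matchedEdge-of-end M-pm w∼)) (∈closure⁻ v∈X′))

    matchedEdge-∈M∩∂X : ∀ {v} → v ∈ closure ─ X → matchedEdge M-pm v ∈ M ∩ cut G X
    matchedEdge-∈M∩∂X {v} v∈X′─X =
      x∈p∩q⁺ (matchedEdge-∈ M-pm v ,
              incident-∉⇒Touches⇒∈cut (matchedEdge-incident M-pm v) (x∈p─q⇒x∉q closure X v∈X′─X)
                                      (∈closure⁻ (p─q⊆p closure X v∈X′─X)))

    matchedEdge-injective : ∀ {v w} → v ∈ closure ─ X → w ∈ closure ─ X →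
                            matchedEdge M-pm v ≡ matchedEdge M-pm w → v ≡ w
    matchedEdge-injective {v} {w} v∈X′─X w∈X′─X eq =
      Touches⇒ends-∉-unique (∈closure⁻ (p─q⊆p closure X v∈X′─X))
        (matchedEdge-incident M-pm v) (subst (λ e → Incident G e w) (sym eq) (matchedEdge-incident M-pm w))
        (x∈p─q⇒x∉q closure X v∈X′─X) (x∈p─q⇒x∉q closure X w∈X′─X)

    ∣closure─X∣≤∣M∩∂X∣ : ∣ closure ─ X ∣ ≤ ∣ M ∩ cut G X ∣
    ∣closure─X∣≤∣M∩∂X∣ = injection⇒∣p∣≤∣q∣ (λ v e → matchedEdge M-pm v ≡ e)
      (λ {v} v∈X′─X → matchedEdge M-pm v , matchedEdge-∈M∩∂X v∈X′─X , refl)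
      (λ v∈X′─X w∈X′─X v↦e w↦e → matchedEdge-injective v∈X′─X w∈X′─X (trans v↦e (sym w↦e)))

    ∣closure∣≤∣X∣+∣M∩∂X∣ : ∣ closure ∣ ≤ ∣ X ∣ + ∣ M ∩ cut G X ∣
    ∣closure∣≤∣X∣+∣M∩∂X∣ = begin
      ∣ closure ∣                         ≡⟨ ∣p∣≡∣p∩q∣+∣p─q∣ closure X ⟩
      ∣ closure ∩ X ∣ + ∣ closure ─ X ∣   ≤⟨ +-mono-≤ (∣p∩q∣≤∣q∣ closure X) ∣closure─X∣≤∣M∩∂X∣ ⟩
      ∣ X ∣ + ∣ M ∩ cut G X ∣             ∎
      where open ≤-Reasoning

    ∣N∩∂closure∣≤∣N∩∂X∣+∣M∩∂X∣ : ∀ {N} → PerfectMatching G N →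
                                 ∣ N ∩ cut G closure ∣ ≤ ∣ N ∩ cut G X ∣ + ∣ M ∩ cut G X ∣
    ∣N∩∂closure∣≤∣N∩∂X∣+∣M∩∂X∣ {N} N-pm = begin
      ∣ N∩∂X′ ∣                                 ≡⟨ ∣p∣≡∣p∩q∣+∣p─q∣ N∩∂X′ (cut G X) ⟩
      ∣ N∩∂X′ ∩ cut G X ∣ + ∣ N∩∂X′ ─ cut G X ∣  ≤⟨ +-mono-≤ (p⊆q⇒∣p∣≤∣q∣ N∩∂X′∩∂X⊆N∩∂X) ∣N∩∂X′─∂X∣≤∣X′─X∣ ⟩
      ∣ N ∩ cut G X ∣ + ∣ closure ─ X ∣          ≤⟨ +-monoʳ-≤ ∣ N ∩ cut G X ∣ ∣closure─X∣≤∣M∩∂X∣ ⟩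
      ∣ N ∩ cut G X ∣ + ∣ M ∩ cut G X ∣          ∎
      where
      open ≤-Reasoning
      N∩∂X′ : Subset (m G)
      N∩∂X′ = N ∩ cut G closure

      N∩∂X′∩∂X⊆N∩∂X : N∩∂X′ ∩ cut G X ⊆ N ∩ cut G X
      N∩∂X′∩∂X⊆N∩∂X {e} e∈ = x∈p∩q⁺ (p∩q⊆p N _ (p∩q⊆p N∩∂X′ _ e∈) , p∩q⊆q N∩∂X′ _ e∈)

      ∣N∩∂X′─∂X∣≤∣X′─X∣ : ∣ N∩∂X′ ─ cut G X ∣ ≤ ∣ closure ─ X ∣
      ∣N∩∂X′─∂X∣≤∣X′─X∣ = injection⇒∣p∣≤∣q∣ (Incident G)
        (λ e∈ → ∈cut-∉cut⇒end∈─ X⊆closure (p∩q⊆q N _ (p─q⊆p N∩∂X′ _ e∈)) (x∈p─q⇒x∉q N∩∂X′ _ e∈))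
        (λ e∈ e′∈ e∼v e′∼v → trans (matchedEdge-unique N-pm (∈N e∈) e∼v)
                                   (sym (matchedEdge-unique N-pm (∈N e′∈) e′∼v)))
        where
        ∈N : ∀ {e} → e ∈ N∩∂X′ ─ cut G X → e ∈ N
        ∈N e∈ = p∩q⊆p N _ (p─q⊆p N∩∂X′ _ e∈)

proposition4p4 : (G : Graph) → MatchingCovered G → (X : Subset (n G)) → (M : Subset (m G)) → PerfectMatching G M → (k : ℕ) → IsMP G X k → Σ (Subset (n G)) λ X′ → Conformal G M X′ × X ⊆ X′ × ∣ X′ ∣ ≤ ∣ X ∣ + k × Σ ℕ λ k′ → IsMP G X′ k′ × k′ ≤ 2 * k
proposition4p4 G _ X M M-pm k (_ , mp≤k) =
  closure G X M-pm , closure-conformal G X M-pm , X⊆closure G X M-pm ,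
  ≤-trans (∣closure∣≤∣X∣+∣M∩∂X∣ G X M-pm) (+-monoʳ-≤ ∣ X ∣ ∣M∩∂X∣≤k) ,
  IsMP-exists G M-pm (closure G X M-pm) (2 * k) λ N N-pm →
    ≤-trans (∣N∩∂closure∣≤∣N∩∂X∣+∣M∩∂X∣ G X M-pm N-pm)
            (+-mono-≤ (mp≤k N N-pm) (≤-trans ∣M∩∂X∣≤k (m≤m+n k 0)))  -- 2 * k unfolds to k + (k + 0)
  where
  ∣M∩∂X∣≤k : ∣ M ∩ cut G X ∣ ≤ k
  ∣M∩∂X∣≤k = mp≤k M M-pm
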